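{- Let $G$ be a connected graph of order $n\geq 4$. Then $\chi_d^t(C(G))=n+\lceil n/2\rceil$ if and only if $G$ is isomorphic to the complete graph $K_n$.
   Context: All graphs are finite, simple and undirected. For a graph $G=(V,E)$ with $V=\{v_1,\dots,v_n\}$, the central graph $C(G)$ is the graph with vertex set $V\cup\{c_{ij} : v_iv_j\in E\}$ obtained by subdividing each edge $v_iv_j$ of $G$ exactly once by a new vertex $c_{ij}$ (adjacent to exactly $v_i$ and $v_j$) and joining every pair of distinct vertices non-adjacent in $G$. A total dominator coloring (TDC) of a graph $H$ with no isolated vertices is a proper vertex coloring of $H$ in which every vertex is adjacent to all vertices of some color class. $\chi_d^t(H)$ is the minimum number of color classes in a TDC of $H$. -}

module Defs where

open import Data.Nat using (ℕ; _<_)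
open import Data.Fin using (Fin; toℕ)
open import Data.Bool using (Bool; true; false; T)
open import Data.Product using (Σ; ∃; _×_; _,_; proj₁; proj₂)
open import Data.Sum using (_⊎_; inj₁; inj₂)
open import Relation.Binary.PropositionalEquality using (_≡_; _≢_)
open import Relation.Binary.Construct.Closure.ReflexiveTransitive using (Star)
open import Relation.Nullary using (¬_)
open import Function.Bundles using (_↔_; Inverse)
open import Data.Bool using (not)
open import Data.Fin using (_≟_)
open import Data.Empty using (⊥; ⊥-elim)
open import Relation.Nullary using (yes; no)
open import Relation.Nullary.Decidable using (⌊_⌋)
import Relation.Binary.PropositionalEquality as ≡
open import Relation.Binary.PropositionalEquality using (refl)
import Data.Nat

record Graph (n : ℕ) : Set where
  field
    adj   : Fin n → Fin n → Bool
    sym   : ∀ i j → adj i j ≡ adj j i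
    irref : ∀ i → adj i i ≡ false
open Graph public

Adj : ∀ {n} → Graph n → Fin n → Fin n → Set
Adj G i j = T (adj G i j)

Connected : ∀ {n} → Graph n → Set
Connected G = ∀ i j → Star (Adj G) i j

Kadj : ∀ {n} → Fin n → Fin n → Bool
Kadj i j = not ⌊ i ≟ j ⌋

Kadj-sym : ∀ {n} (i j : Fin n) → Kadj i j ≡ Kadj j i
Kadj-sym i j with i ≟ j | j ≟ i
... | yes _ | yes _ = refl
... | no _  | no _  = refl
... | yes p | no q  = ⊥-elim (q (≡.sym p))
... | no p  | yes q = ⊥-elim (p (≡.sym q))

Kadj-irr : ∀ {n} (i : Fin n) → Kadj i i ≡ false
Kadj-irr i with i ≟ i
... | yes _ = refl
... | no ¬p = ⊥-elim (¬p refl)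

K : (n : ℕ) → Graph n
K n = record { adj = Kadj ; sym = Kadj-sym ; irref = Kadj-irr }

_≅_ : ∀ {n} → Graph n → Graph n → Set
_≅_ {n} G H = Σ (Fin n ↔ Fin n) λ f →
  ∀ i j → adj G i j ≡ adj H (Inverse.to f i) (Inverse.to f j)

Edge : ∀ {n} → Graph n → Set
Edge {n} G = Σ (Fin n × Fin n) λ p → (toℕ (proj₁ p) < toℕ (proj₂ p)) × Adj G (proj₁ p) (proj₂ p)

-- Vertex set of the central graph C(G): original vertices v_i, plus one
-- subdivision vertex c_ij per edge v_i v_j of G.
CVertex : ∀ {n} → Graph n → Set
CVertex {n} G = Fin n ⊎ Edge G

CAdj : ∀ {n} (G : Graph n) → CVertex G → CVertex G → Set
CAdj G (inj₁ i) (inj₁ j) = i ≢ j × adj G i j ≡ false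
CAdj G (inj₁ k) (inj₂ ((i , j) , _)) = k ≡ i ⊎ k ≡ j
CAdj G (inj₂ ((i , j) , _)) (inj₁ k) = k ≡ i ⊎ k ≡ j
CAdj G (inj₂ _) (inj₂ _) = ⊥

record AbsGraph : Set₁ where
  field
    V   : Set
    _~_ : V → V → Set

C : ∀ {n} → Graph n → AbsGraph
C G = record { V = CVertex G ; _~_ = CAdj G }

-- A total dominator coloring of H with exactly k (nonempty) color classes:
-- a surjective map c : V → Fin k which is a proper coloring and such that
-- every vertex is adjacent to all vertices of some color class.
record TDC (H : AbsGraph) (k : ℕ) : Set where
  open AbsGraph H
  field
    col        : V → Fin k
    surjective : ∀ (j : Fin k) → ∃ λ v → col v ≡ j
    proper     : ∀ u v → u ~ v → col u ≢ col v
    dominating : ∀ v → ∃ λ (j : Fin k) → ∀ u → col u ≡ j → v ~ u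

TDCNumberIs : AbsGraph → ℕ → Set
TDCNumberIs H m = TDC H m × (∀ k → k Data.Nat.< m → ¬ TDC H k)

-- In C(K_n) the original vertices are pairwise non-adjacent and the subdivision vertex c_ij is
-- adjacent to v_i and v_j only, so the class dominated by c_ij lies inside {v_i, v_j}.  Hence every
-- colour holds at most two original vertices, at most one colour holds two, and a class dominated by
-- an original vertex holds none and is dominated by at most two of them.  Counting colour classes
-- by these kinds gives at least n + ⌈n/2⌉ colours; in the one tight case (a colour holding two
-- original vertices and at most one class dominated by a single original vertex), one of the
-- colours of two subdivision vertices c_im, c_im′ is a class of neither kind.
--
-- Conversely, pair off the universal vertices (in K_n all of them) by consecutive rank: partners
-- x, y are dominated by the class {c_xy}, an unpaired x by a class of subdivision vertices at x.
-- Two universal vertices u₀, u₁ give non-adjacent v_u₀, v_u₁ in C(G), which may share a colour;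
-- the freed colour takes all remaining subdivision vertices and every other v_x keeps a colour of
-- its own.  With u universal vertices this uses n + ⌈u/2⌉ colours, so n + ⌈n/2⌉ for K_n.  If G is
-- not complete, two vertices are not universal (each dominated by the singleton class of a
-- non-universal non-neighbour), so u ≤ n − 2; with at most one universal vertex n + 1 colours
-- suffice.  Either way fewer than n + ⌈n/2⌉ colours are needed.

module Submission where

open import Defs hiding (sym)
open import Level using (0ℓ)
open import Data.Nat
  using (ℕ; zero; suc; pred; _+_; _≤_; _<_; z≤n; s≤s; _≤?_; _<?_; ⌊_/2⌋; ⌈_/2⌉; >-nonZero)
import Data.Nat as ℕ
open import Data.Nat.Properties hiding (_≟_; suc-injective)
open import Data.Nat.Tactic.RingSolver using (solve-∀)
open import Data.Fin using (Fin; zero; suc; toℕ; fromℕ<; punchOut; _≟_)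
open import Data.Fin.Properties
  using (suc-injective; toℕ-injective; toℕ<n; toℕ-fromℕ<; punchOut-injective; any?; all?; ¬∀⟶∃¬)
open import Data.Bool using (T; true; false)
open import Data.Bool.Properties using (T?; T-irrelevant)
open import Data.Product using (Σ; ∃; _×_; _,_; proj₁; proj₂)
open import Data.Product.Properties using (×-≡,≡→≡)
open import Data.Sum using (_⊎_; inj₁; inj₂)
import Data.Sum as Sum
open import Data.Empty using (⊥; ⊥-elim)
open import Function using (_∘_)
open import Function.Bundles using (_⇔_; mk⇔; Injection)
open import Function.Properties.Inverse using (↔⇒↣)
open import Function.Construct.Identity using (↔-id)
open import Relation.Nullary using (¬_; Dec; yes; no; ¬?; _×-dec_; _⊎-dec_; _→-dec_; contradiction)
open import Relation.Unary using (Pred; Decidable; Irrelevant; _⊆_)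
open import Relation.Unary.Properties using (∁?)
open import Relation.Binary using (tri<; tri≈; tri>)
open import Relation.Binary.PropositionalEquality
open import Algebra.Properties.Semiring.Sum +-*-semiring using (sum; sum-cong-≗; ∑-comm; ∑-distrib-+)

no-three-in-two : ∀ {A : Set} {x y z p q : A} → x ≢ y → x ≢ z → y ≢ z →
                  x ≡ p ⊎ x ≡ q → y ≡ p ⊎ y ≡ q → z ≡ p ⊎ z ≡ q → ⊥
no-three-in-two x≢y _ _ (inj₁ refl) (inj₁ refl) _ = x≢y refl
no-three-in-two x≢y _ _ (inj₂ refl) (inj₂ refl) _ = x≢y refl
no-three-in-two _ x≢z _ (inj₁ refl) _ (inj₁ refl) = x≢z refl
no-three-in-two _ x≢z _ (inj₂ refl) _ (inj₂ refl) = x≢z refl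
no-three-in-two _ _ y≢z _ (inj₁ refl) (inj₁ refl) = y≢z refl
no-three-in-two _ _ y≢z _ (inj₂ refl) (inj₂ refl) = y≢z refl

pair-cover : ∀ {A : Set} {a b s t x : A} → s ≡ a ⊎ s ≡ b → t ≡ a ⊎ t ≡ b → s ≢ t →
             x ≡ a ⊎ x ≡ b → x ≡ s ⊎ x ≡ t
pair-cover (inj₁ refl) (inj₁ refl) s≢t _  = ⊥-elim (s≢t refl)
pair-cover (inj₂ refl) (inj₂ refl) s≢t _  = ⊥-elim (s≢t refl)
pair-cover (inj₁ refl) (inj₂ refl) _   x∈ = x∈
pair-cover (inj₂ refl) (inj₁ refl) _   x∈ = Sum.swap x∈

half-cases : ∀ a → a ≡ ⌊ a /2⌋ + ⌊ a /2⌋ ⊎ a ≡ suc (⌊ a /2⌋ + ⌊ a /2⌋)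
half-cases zero          = inj₁ refl
half-cases (suc zero)    = inj₂ refl
half-cases (suc (suc a)) with half-cases a
... | inj₁ a≡ = inj₁ (cong suc (trans (cong suc a≡) (sym (+-suc ⌊ a /2⌋ ⌊ a /2⌋))))
... | inj₂ a≡ = inj₂ (cong suc (trans (cong suc a≡) (cong suc (sym (+-suc ⌊ a /2⌋ ⌊ a /2⌋)))))

⌊/2⌋-fibres : ∀ {a b c} → a ≢ b → a ≢ c → b ≢ c →
              ⌊ a /2⌋ ≡ ⌊ b /2⌋ → ⌊ a /2⌋ ≡ ⌊ c /2⌋ → ⊥
⌊/2⌋-fibres {a} {b} {c} a≢b a≢c b≢c ab ac = no-three-in-two a≢b a≢c b≢c (half-cases a)
  (subst (λ H → b ≡ H + H ⊎ b ≡ suc (H + H)) (sym ab) (half-cases b))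
  (subst (λ H → c ≡ H + H ⊎ c ≡ suc (H + H)) (sym ac) (half-cases c))

⌈X+X+Y/2⌉ : ∀ X Y → ⌈ X + X + Y /2⌉ ≡ X + ⌈ Y /2⌉
⌈X+X+Y/2⌉ zero    Y = refl
⌈X+X+Y/2⌉ (suc X) Y rewrite +-suc X X = cong suc (⌈X+X+Y/2⌉ X Y)

⌈Y/2⌉+T≤Y+Z : ∀ {T Y Z} → T ≤ 1 → (T ≡ 1 → Y ≤ 1 → 1 ≤ Z) → ⌈ Y /2⌉ + T ≤ Y + Z
⌈Y/2⌉+T≤Y+Z {zero}        {Y}           {Z} _ _   =
  ≤-trans (≤-reflexive (+-identityʳ _)) (≤-trans (⌈n/2⌉≤n Y) (m≤m+n Y Z))
⌈Y/2⌉+T≤Y+Z {suc zero}    {zero}        {Z} _ Z≥1 = Z≥1 refl z≤n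
⌈Y/2⌉+T≤Y+Z {suc zero}    {suc zero}    {Z} _ Z≥1 = s≤s (Z≥1 refl ≤-refl)
⌈Y/2⌉+T≤Y+Z {suc zero}    {suc (suc Y)} {Z} _ _   =
  s≤s (≤-trans (≤-reflexive (+-comm _ 1)) (s≤s (≤-trans (⌈n/2⌉≤n Y) (m≤m+n Y Z))))
⌈Y/2⌉+T≤Y+Z {suc (suc _)} (s≤s ())

n+⌈n/2⌉≤k : ∀ {n k T X Y Z} → n ≡ X + X + Y → n + X + Y + Z ≤ k + T → T ≤ 1 →
            (T ≡ 1 → Y ≤ 1 → 1 ≤ Z) → n + ⌈ n /2⌉ ≤ k
n+⌈n/2⌉≤k {k = k} {T} {X} {Y} {Z} refl budget T≤1 Z≥1 = +-cancelʳ-≤ T _ _ (begin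
  (X + X + Y) + ⌈ X + X + Y /2⌉ + T  ≡⟨ cong (λ h → X + X + Y + h + T) (⌈X+X+Y/2⌉ X Y) ⟩
  (X + X + Y) + (X + ⌈ Y /2⌉) + T    ≡⟨ regroup (X + X + Y) X ⌈ Y /2⌉ T ⟩
  (X + X + Y) + X + (⌈ Y /2⌉ + T)    ≤⟨ +-monoʳ-≤ (X + X + Y + X) (⌈Y/2⌉+T≤Y+Z T≤1 Z≥1) ⟩
  (X + X + Y) + X + (Y + Z)          ≡⟨ +-assoc (X + X + Y + X) Y Z ⟨
  (X + X + Y) + X + Y + Z            ≤⟨ budget ⟩
  k + T                              ∎)
  where
  open ≤-Reasoning
  regroup : ∀ a b c d → a + (b + c) + d ≡ a + b + (c + d)
  regroup = solve-∀

2+n+⌊r/2⌋≤n+⌈n/2⌉ : ∀ {r n} → 3 + r ≤ n → 2 + (n + ⌊ r /2⌋) ≤ n + ⌈ n /2⌉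
2+n+⌊r/2⌋≤n+⌈n/2⌉ {r} {n} 3+r≤n = begin
  2 + (n + ⌊ r /2⌋)        ≡⟨ cong suc (+-suc n ⌊ r /2⌋) ⟨
  suc (n + suc ⌊ r /2⌋)    ≡⟨ +-suc n (suc ⌊ r /2⌋) ⟨
  n + suc (suc ⌊ r /2⌋)    ≤⟨ +-monoʳ-≤ n (⌊n/2⌋-mono (s≤s 3+r≤n)) ⟩
  n + ⌈ n /2⌉              ∎
  where open ≤-Reasoning

-- Counting over Fin n

𝟙 : ∀ {A : Set} → Dec A → ℕ
𝟙 (yes _) = 1
𝟙 (no _)  = 0

sum-mono : ∀ {n} {f g : Fin n → ℕ} → (∀ i → f i ≤ g i) → sum f ≤ sum g
sum-mono {zero}  f≤g = z≤n
sum-mono {suc n} f≤g = +-mono-≤ (f≤g zero) (sum-mono (f≤g ∘ suc))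

sum-ones : ∀ n → sum {n} (λ _ → 1) ≡ n
sum-ones zero    = refl
sum-ones (suc n) = cong suc (sum-ones n)

count : ∀ {n} {P : Pred (Fin n) 0ℓ} → Decidable P → ℕ
count P? = sum (λ i → 𝟙 (P? i))

count≡0 : ∀ {n} {P : Pred (Fin n) 0ℓ} (P? : Decidable P) → (∀ i → ¬ P i) → count P? ≡ 0
count≡0 {zero}  P? ¬P = refl
count≡0 {suc n} P? ¬P with P? zero
... | yes p = contradiction p (¬P zero)
... | no _  = count≡0 (P? ∘ suc) (¬P ∘ suc)

count⇒∃ : ∀ {n} {P : Pred (Fin n) 0ℓ} (P? : Decidable P) → 1 ≤ count P? → ∃ P
count⇒∃ {suc n} P? c≥1 with P? zero
... | yes p = zero , p
... | no _ with count⇒∃ (P? ∘ suc) c≥1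
...   | i , p = suc i , p

count-mono : ∀ {n} {P Q : Pred (Fin n) 0ℓ} (P? : Decidable P) (Q? : Decidable Q) →
             P ⊆ Q → count P? ≤ count Q?
count-mono P? Q? P⊆Q = sum-mono (λ i → 𝟙-mono (P? i) (Q? i) P⊆Q)
  where
  𝟙-mono : ∀ {A B : Set} (A? : Dec A) (B? : Dec B) → (A → B) → 𝟙 A? ≤ 𝟙 B?
  𝟙-mono (no _)  _       _   = z≤n
  𝟙-mono (yes _) (yes _) _   = ≤-refl
  𝟙-mono (yes a) (no ¬b) A⇒B = contradiction (A⇒B a) ¬b

count-cong : ∀ {n} {P Q : Pred (Fin n) 0ℓ} (P? : Decidable P) (Q? : Decidable Q) →
             P ⊆ Q → Q ⊆ P → count P? ≡ count Q?
count-cong P? Q? P⊆Q Q⊆P = ≤-antisym (count-mono P? Q? P⊆Q) (count-mono Q? P? Q⊆P)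

_-?_ : ∀ {n} {P : Pred (Fin n) 0ℓ} → Decidable P → (a : Fin n) → Decidable (λ i → P i × i ≢ a)
(P? -? a) i = P? i ×-dec ¬? (i ≟ a)

count-remove : ∀ {n} {P : Pred (Fin n) 0ℓ} (P? : Decidable P) {a : Fin n} → P a →
               count P? ≡ suc (count (P? -? a))
count-remove {suc n} P? {zero} pa with P? zero
... | no ¬pa = contradiction pa ¬pa
... | yes _  = cong suc (count-cong (P? ∘ suc) ((P? -? zero) ∘ suc) (λ p → p , λ ()) proj₁)
count-remove {suc n} {P} P? {suc a} pa = begin
  𝟙 (P? zero) + count (P? ∘ suc)
    ≡⟨ cong (𝟙 (P? zero) +_) (count-remove (P? ∘ suc) pa) ⟩
  𝟙 (P? zero) + suc (count ((P? ∘ suc) -? a))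
    ≡⟨ +-suc _ _ ⟩
  suc (𝟙 (P? zero) + count ((P? ∘ suc) -? a))
    ≡⟨ cong suc (cong₂ _+_ (𝟙-zero (P? zero)) shifted) ⟩
  suc (𝟙 ((P? -? suc a) zero) + count ((P? -? suc a) ∘ suc)) ∎
  where
  open ≡-Reasoning
  𝟙-zero : (A? : Dec (P zero)) → 𝟙 A? ≡ 𝟙 (A? ×-dec ¬? (zero ≟ suc a))
  𝟙-zero (yes _) = refl
  𝟙-zero (no _)  = refl
  shifted : count ((P? ∘ suc) -? a) ≡ count ((P? -? suc a) ∘ suc)
  shifted = count-cong ((P? ∘ suc) -? a) ((P? -? suc a) ∘ suc)
    (λ (p , i≢a) → p , i≢a ∘ suc-injective) (λ (p , si≢sa) → p , si≢sa ∘ cong suc)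

count-complement : ∀ {n} {P : Pred (Fin n) 0ℓ} (P? : Decidable P) → count P? + count (∁? P?) ≡ n
count-complement {n} P? = begin
  count P? + count (∁? P?)            ≡⟨ ∑-distrib-+ (λ i → 𝟙 (P? i)) (λ i → 𝟙 (∁? P? i)) ⟨
  sum (λ i → 𝟙 (P? i) + 𝟙 (∁? P? i))  ≡⟨ sum-cong-≗ (λ i → 𝟙-excluded-middle (P? i)) ⟩
  sum {n} (λ _ → 1)                   ≡⟨ sum-ones n ⟩
  n                                   ∎
  where
  open ≡-Reasoning
  𝟙-excluded-middle : ∀ {A : Set} (A? : Dec A) → 𝟙 A? + 𝟙 (¬? A?) ≡ 1
  𝟙-excluded-middle (yes _) = refl
  𝟙-excluded-middle (no _)  = refl

count≥1 : ∀ {n} {P : Pred (Fin n) 0ℓ} (P? : Decidable P) {a : Fin n} → P a → 1 ≤ count P?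
count≥1 P? pa rewrite count-remove P? pa = s≤s z≤n

count≥2 : ∀ {n} {P : Pred (Fin n) 0ℓ} (P? : Decidable P) {a b : Fin n} →
          a ≢ b → P a → P b → 2 ≤ count P?
count≥2 P? a≢b pa pb rewrite count-remove P? pa = s≤s (count≥1 (P? -? _) (pb , ≢-sym a≢b))

count≥2⇒∃₂ : ∀ {n} {P : Pred (Fin n) 0ℓ} (P? : Decidable P) → 2 ≤ count P? →
             ∃ λ a → ∃ λ b → a ≢ b × P a × P b
count≥2⇒∃₂ P? c≥2 with count⇒∃ P? (≤-trans (s≤s z≤n) c≥2)
... | a , pa with count⇒∃ (P? -? a) (≤-pred (subst (2 ≤_) (count-remove P? pa) c≥2))
...   | b , pb , b≢a = a , b , ≢-sym b≢a , pa , pb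

count≤1 : ∀ {n} {P : Pred (Fin n) 0ℓ} (P? : Decidable P) → (∀ {a b} → P a → P b → a ≡ b) →
          count P? ≤ 1
count≤1 P? unique with 2 ≤? count P?
... | no c≱2  = ≤-pred (≰⇒> c≱2)
... | yes c≥2 with count≥2⇒∃₂ P? c≥2
...   | a , b , a≢b , pa , pb = contradiction (unique pa pb) a≢b

count≤1⇒unique : ∀ {n} {P : Pred (Fin n) 0ℓ} (P? : Decidable P) → count P? ≤ 1 →
                 ∀ {a b} → P a → P b → a ≡ b
count≤1⇒unique P? c≤1 {a} {b} pa pb with a ≟ b
... | yes a≡b = a≡b
... | no a≢b  = contradiction (≤-trans (count≥2 P? a≢b pa pb) c≤1) λ { (s≤s ()) }

count≤2 : ∀ {n} {P : Pred (Fin n) 0ℓ} (P? : Decidable P) →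
          (∀ {a b c} → a ≢ b → a ≢ c → b ≢ c → P a → P b → P c → ⊥) → count P? ≤ 2
count≤2 {P = P} P? no-three with 1 ≤? count P?
... | no c≱1  = ≤-trans (≤-pred (≰⇒> c≱1)) z≤n
... | yes c≥1 with count⇒∃ P? c≥1
...   | a , pa rewrite count-remove P? pa = s≤s (count≤1 (P? -? a) unique)
  where
  unique : ∀ {b c} → P b × b ≢ a → P c × c ≢ a → b ≡ c
  unique {b} {c} (pb , b≢a) (pc , c≢a) with b ≟ c
  ... | yes b≡c = b≡c
  ... | no b≢c  = ⊥-elim (no-three (≢-sym b≢a) (≢-sym c≢a) b≢c pa pb pc)

fibre-count-sum : ∀ {n k} (f : Fin n → Fin k) → sum (λ j → count (λ i → f i ≟ j)) ≡ n
fibre-count-sum {n} f = begin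
  sum (λ j → sum (λ i → 𝟙 (f i ≟ j)))  ≡⟨ ∑-comm (λ j i → 𝟙 (f i ≟ j)) ⟩
  sum (λ i → sum (λ j → 𝟙 (f i ≟ j)))  ≡⟨ sum-cong-≗ (count-≡ ∘ f) ⟩
  sum {n} (λ _ → 1)                    ≡⟨ sum-ones n ⟩
  n                                    ∎
  where
  open ≡-Reasoning
  count-≡ : ∀ {m} (x : Fin m) → count (x ≟_) ≡ 1
  count-≡ x = ≤-antisym (count≤1 (x ≟_) (λ x≡a x≡b → trans (sym x≡a) x≡b)) (count≥1 (x ≟_) refl)

two-others : ∀ {n} → 4 ≤ n → (i i′ : Fin n) →
             ∃ λ m₁ → ∃ λ m₂ → m₁ ≢ m₂ × (m₁ ≢ i × m₁ ≢ i′) × (m₂ ≢ i × m₂ ≢ i′)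
two-others 4≤n i i′ with count≥2⇒∃₂ (∁? one-of?) (+-cancelʳ-≤ (count one-of?) 2 _ 2+≤n)
  where
  one-of? : Decidable (λ m → m ≡ i ⊎ m ≡ i′)
  one-of? m = (m ≟ i) ⊎-dec (m ≟ i′)
  2+≤n : 2 + count one-of? ≤ count (∁? one-of?) + count one-of?
  2+≤n = ≤-trans (+-monoʳ-≤ 2 (count≤2 one-of? no-three-in-two))
           (≤-trans 4≤n (≤-reflexive (trans (sym (count-complement one-of?)) (+-comm (count one-of?) _))))
... | m₁ , m₂ , m₁≢m₂ , m₁∉ , m₂∉ =
  m₁ , m₂ , m₁≢m₂ , (m₁∉ ∘ inj₁ , m₁∉ ∘ inj₂) , (m₂∉ ∘ inj₁ , m₂∉ ∘ inj₂)

rank : ∀ {n} {P : Pred (Fin n) 0ℓ} → Decidable P → Fin n → ℕ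
rank P? x = count (λ y → (toℕ y <? toℕ x) ×-dec P? y)

rank<count : ∀ {n} {P Q : Pred (Fin n) 0ℓ} (P? : Decidable P) (Q? : Decidable Q) {x} → Q x →
             (∀ {y} → toℕ y < toℕ x → P y → Q y) → rank P? x < count Q?
rank<count P? Q? {x} qx below⊆Q rewrite count-remove Q? qx =
  s≤s (count-mono _ (Q? -? x) λ (y<x , py) → below⊆Q y<x py , λ { refl → <-irrefl refl y<x })

rank-strict : ∀ {n} {P : Pred (Fin n) 0ℓ} (P? : Decidable P) {x y} → P x → toℕ x < toℕ y →
              rank P? x < rank P? y
rank-strict P? {x} {y} px x<y =
  rank<count P? (λ z → (toℕ z <? toℕ y) ×-dec P? z) (x<y , px) λ z<x pz → <-trans z<x x<y , pz

rank-injective : ∀ {n} {P : Pred (Fin n) 0ℓ} (P? : Decidable P) {x y} → P x → P y →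
                 rank P? x ≡ rank P? y → x ≡ y
rank-injective P? {x} {y} px py rx≡ry with <-cmp (toℕ x) (toℕ y)
... | tri< x<y _ _ = contradiction rx≡ry (<⇒≢ (rank-strict P? px x<y))
... | tri≈ _ x≡y _ = toℕ-injective x≡y
... | tri> _ _ y<x = contradiction (sym rx≡ry) (<⇒≢ (rank-strict P? py y<x))

-- Colourings with possibly empty colour classes

Searchable : Set → Set₁
Searchable A = ∀ {P : Pred A 0ℓ} → Decidable P → Dec (∃ P)

searchable-Fin : ∀ n → Searchable (Fin n)
searchable-Fin n = any?

searchable-⊎ : ∀ {A B : Set} → Searchable A → Searchable B → Searchable (A ⊎ B)
searchable-⊎ search-A search-B P? with search-A (P? ∘ inj₁) | search-B (P? ∘ inj₂)
... | yes (a , p) | _           = yes (inj₁ a , p)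
... | no _        | yes (b , p) = yes (inj₂ b , p)
... | no ¬a       | no ¬b       = no λ { (inj₁ a , p) → ¬a (a , p) ; (inj₂ b , p) → ¬b (b , p) }

searchable-× : ∀ {A B : Set} → Searchable A → Searchable B → Searchable (A × B)
searchable-× search-A search-B P? with search-A (λ a → search-B (λ b → P? (a , b)))
... | yes (a , b , p) = yes ((a , b) , p)
... | no ¬p           = no λ { ((a , b) , p) → ¬p (a , b , p) }

searchable-Σ : ∀ {A : Set} {B : Pred A 0ℓ} → Searchable A → Decidable B → Irrelevant B →
               Searchable (Σ A B)
searchable-Σ {B = B} search-A B? B-irrelevant {P} P? with search-A witness?
  where
  witness? : Decidable (λ a → Σ (B a) λ b → P (a , b))
  witness? a with B? a
  ... | no ¬b = no λ (b , _) → ¬b b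
  ... | yes b with P? (a , b)
  ...   | yes p = yes (b , p)
  ...   | no ¬p = no λ (b′ , p) → ¬p (subst (λ b → P (a , b)) (B-irrelevant b′ b) p)
... | yes (a , b , p) = yes ((a , b) , p)
... | no ¬p           = no λ { ((a , b) , p) → ¬p (a , b , p) }

module _ (H : AbsGraph) where
  open AbsGraph H

  Proper : {C : Set} → (V → C) → Set
  Proper c = ∀ u v → u ~ v → c u ≢ c v

  Dominated : {C : Set} → (V → C) → V → Set
  Dominated c v = ∃ λ w → ∀ u → c u ≡ c w → v ~ u

  Dominating : {C : Set} → (V → C) → Set
  Dominating c = ∀ v → Dominated c v

  module _ {C D : Set} {c : V → C} (d : V → D) (d-finer : ∀ u v → d u ≡ d v → c u ≡ c v) where

    proper-finer : Proper c → Proper d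
    proper-finer c-proper u v u~v = c-proper u v u~v ∘ d-finer u v

    dominating-finer : Dominating c → Dominating d
    dominating-finer c-dominating v with c-dominating v
    ... | w , dominated = w , λ u du≡dw → dominated u (d-finer u w du≡dw)

  compress : Searchable V → ∀ {K} (c : V → Fin K) → Proper c → Dominating c →
             ∃ λ k → k ≤ K × TDC H k
  compress search {K} c c-proper c-dominating with all? (λ j → search (λ v → c v ≟ j))
  ... | yes all-used = K , ≤-refl , record
    { col        = c
    ; surjective = all-used
    ; proper     = c-proper
    ; dominating = λ v → let (w , dominated) = c-dominating v in c w , dominated
    }
  compress search {zero} c _ _ | no some-unused = contradiction (λ ()) some-unused
  compress search {suc K} c c-proper c-dominating | no some-unused
    with ¬∀⟶∃¬ (suc K) _ (λ j → search (λ v → c v ≟ j)) some-unused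
  ... | j , unused
    with compress search c′ (proper-finer c′ c′-finer c-proper) (dominating-finer c′ c′-finer c-dominating)
    where
    j≢c : ∀ v → j ≢ c v
    j≢c v j≡cv = unused (v , sym j≡cv)
    c′ : V → Fin K
    c′ v = punchOut (j≢c v)
    c′-finer : ∀ u v → c′ u ≡ c′ v → c u ≡ c v
    c′-finer u v = punchOut-injective (j≢c u) (j≢c v)
  ... | k , k≤K , tdc = k , m≤n⇒m≤1+n k≤K , tdc

  compress-ℕ : Searchable V → ∀ {K} (c : V → ℕ) → (∀ v → c v < K) → Proper c → Dominating c →
               ∃ λ k → k ≤ K × TDC H k
  compress-ℕ search {K} c c<K c-proper c-dominating =
    compress search c′ (proper-finer c′ c′-finer c-proper) (dominating-finer c′ c′-finer c-dominating)
    where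
    c′ : V → Fin K
    c′ v = fromℕ< (c<K v)
    c′-finer : ∀ u v → c′ u ≡ c′ v → c u ≡ c v
    c′-finer u v c′u≡c′v =
      trans (sym (toℕ-fromℕ< (c<K u))) (trans (cong toℕ c′u≡c′v) (toℕ-fromℕ< (c<K v)))

-- The central graph

module _ {n : ℕ} (G : Graph n) where

  Adj-sym : ∀ {i j} → Adj G i j → Adj G j i
  Adj-sym {i} {j} = subst T (Graph.sym G i j)

  Adj⇒≢ : ∀ {i j} → Adj G i j → i ≢ j
  Adj⇒≢ {i} a refl = subst T (Graph.irref G i) a

  Complete : Set
  Complete = ∀ i j → i ≢ j → Adj G i j

  Universal : Fin n → Set
  Universal x = ∀ y → x ≢ y → Adj G x y

  universal? : Decidable Universal
  universal? x = all? (λ y → ¬? (x ≟ y) →-dec T? (adj G x y))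

  src tgt : Edge G → Fin n
  src ((i , _) , _) = i
  tgt ((_ , j) , _) = j

  src≢tgt : ∀ e → src e ≢ tgt e
  src≢tgt ((i , j) , i<j , _) refl = <-irrefl refl i<j

  edge : ∀ {i j} → Adj G i j → Edge G
  edge {i} {j} a with <-cmp (toℕ i) (toℕ j)
  ... | tri< i<j _ _ = (i , j) , i<j , a
  ... | tri≈ _ i≡j _ = ⊥-elim (Adj⇒≢ a (toℕ-injective i≡j))
  ... | tri> _ _ j<i = (j , i) , j<i , Adj-sym a

  edge-endpoints : ∀ {i j} (a : Adj G i j) →
                   (src (edge a) ≡ i × tgt (edge a) ≡ j) ⊎ (src (edge a) ≡ j × tgt (edge a) ≡ i)
  edge-endpoints {i} {j} a with <-cmp (toℕ i) (toℕ j)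
  ... | tri< _ _ _   = inj₁ (refl , refl)
  ... | tri≈ _ i≡j _ = ⊥-elim (Adj⇒≢ a (toℕ-injective i≡j))
  ... | tri> _ _ _   = inj₂ (refl , refl)

  module _ {R : Fin n → Fin n → Set} (R-sym : ∀ {i j} → R i j → R j i) {i j} (a : Adj G i j) where

    on-edge⁺ : R i j → R (src (edge a)) (tgt (edge a))
    on-edge⁺ r with edge-endpoints a
    ... | inj₁ (s≡i , t≡j) = subst₂ R (sym s≡i) (sym t≡j) r
    ... | inj₂ (s≡j , t≡i) = subst₂ R (sym s≡j) (sym t≡i) (R-sym r)

    on-edge⁻ : R (src (edge a)) (tgt (edge a)) → R i j
    on-edge⁻ r with edge-endpoints a
    ... | inj₁ (s≡i , t≡j) = subst₂ R s≡i t≡j r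
    ... | inj₂ (s≡j , t≡i) = R-sym (subst₂ R s≡j t≡i r)

  edge-incident : ∀ {i j} (a : Adj G i j) {x} → x ≡ i ⊎ x ≡ j → CAdj G (inj₁ x) (inj₂ (edge a))
  edge-incident a = on-edge⁺ Sum.swap a

  incident-edge : ∀ {i j} (a : Adj G i j) {x} → CAdj G (inj₁ x) (inj₂ (edge a)) → x ≡ i ⊎ x ≡ j
  incident-edge a = on-edge⁻ Sum.swap a

  CAdj-sym : ∀ u v → CAdj G u v → CAdj G v u
  CAdj-sym (inj₁ i) (inj₁ j) (i≢j , ¬a) = ≢-sym i≢j , trans (Graph.sym G j i) ¬a
  CAdj-sym (inj₁ _) (inj₂ _) x∈e = x∈e
  CAdj-sym (inj₂ _) (inj₁ _) x∈e = x∈e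

  non-adjacent : ∀ {x y} → x ≢ y → ¬ Adj G x y → CAdj G (inj₁ x) (inj₁ y)
  non-adjacent {x} {y} x≢y ¬a with adj G x y
  ... | false = x≢y , refl
  ... | true  = ⊥-elim (¬a _)

  non-universal-witness : ∀ {x} → ¬ Universal x → ∃ λ y → CAdj G (inj₁ x) (inj₁ y) × ¬ Universal y
  non-universal-witness {x} ¬Ux with ¬∀⟶∃¬ n _ (λ y → ¬? (x ≟ y) →-dec T? (adj G x y)) ¬Ux
  ... | y , ¬[x≢y→xy] = y , non-adjacent x≢y ¬xy , λ Uy → ¬xy (Adj-sym (Uy x (≢-sym x≢y)))
    where
    x≢y : x ≢ y
    x≢y x≡y = ¬[x≢y→xy] λ x≢y → ⊥-elim (x≢y x≡y)
    ¬xy : ¬ Adj G x y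
    ¬xy xy = ¬[x≢y→xy] λ _ → xy

  searchable-CVertex : Searchable (CVertex G)
  searchable-CVertex = searchable-⊎ (searchable-Fin n)
    (searchable-Σ (searchable-× (searchable-Fin n) (searchable-Fin n))
      (λ (i , j) → (toℕ i <? toℕ j) ×-dec T? (adj G i j))
      (λ (i<j , a) (i<j′ , a′) → ×-≡,≡→≡ (<-irrelevant i<j i<j′ , T-irrelevant a a′)))

-- The lower bound for complete graphs

-- For one colour: a original vertices have it and d original vertices dominate its class.
colour-budget : ∀ a d → a ≤ 2 → d ≤ 2 → (1 ≤ a → d ≡ 0) →
                a + 𝟙 (d ℕ.≟ 2) + 𝟙 (d ℕ.≟ 1) + 𝟙 ((a ℕ.≟ 0) ×-dec (d ℕ.≟ 0)) ≤ 1 + 𝟙 (a ℕ.≟ 2)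
colour-budget 0 0 _ _ _ = ≤-refl
colour-budget 0 1 _ _ _ = ≤-refl
colour-budget 0 2 _ _ _ = ≤-refl
colour-budget 1 d _ _ d≡0 rewrite d≡0 (s≤s z≤n) = ≤-refl
colour-budget 2 d _ _ d≡0 rewrite d≡0 (s≤s z≤n) = ≤-refl
colour-budget 0 (suc (suc (suc _))) _ (s≤s (s≤s ())) _
colour-budget (suc (suc (suc _))) _ (s≤s (s≤s ())) _ _

d≤2⇒d≡2+2+1 : ∀ d → d ≤ 2 → d ≡ 𝟙 (d ℕ.≟ 2) + 𝟙 (d ℕ.≟ 2) + 𝟙 (d ℕ.≟ 1)
d≤2⇒d≡2+2+1 0 _ = refl
d≤2⇒d≡2+2+1 1 _ = refl
d≤2⇒d≡2+2+1 2 _ = refl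
d≤2⇒d≡2+2+1 (suc (suc (suc _))) (s≤s (s≤s ()))

module LowerBound {n : ℕ} (G : Graph n) (complete : Complete G) (4≤n : 4 ≤ n)
                  {k : ℕ} (tdc : TDC (C G) k) where
  open TDC tdc

  c : ∀ {i j} → i ≢ j → CVertex G
  c {i} {j} i≢j = inj₂ (edge G (complete i j i≢j))

  colour target : Fin n → Fin k
  colour i = col (inj₁ i)
  target i = proj₁ (dominating (inj₁ i))

  target-dominated : ∀ i u → col u ≡ target i → CAdj G (inj₁ i) u
  target-dominated i = proj₂ (dominating (inj₁ i))

  originals-nonadjacent : ∀ x y → ¬ CAdj G (inj₁ x) (inj₁ y)
  originals-nonadjacent x y (x≢y , ¬xy) = subst T ¬xy (complete x y x≢y)

  inj₁-injective : ∀ {x y : Fin n} → inj₁ {B = Edge G} x ≡ inj₁ y → x ≡ y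
  inj₁-injective refl = refl

  c-neighbours : ∀ {i j} (i≢j : i ≢ j) u → CAdj G (c i≢j) u → u ≡ inj₁ i ⊎ u ≡ inj₁ j
  c-neighbours {i} {j} i≢j (inj₁ x) c~x = Sum.map (cong inj₁) (cong inj₁)
    (incident-edge G (complete i j i≢j) (CAdj-sym G (c i≢j) (inj₁ x) c~x))

  c-class : ∀ {i j} → i ≢ j → Fin k
  c-class i≢j = proj₁ (dominating (c i≢j))

  c-class-within : ∀ {i j} (i≢j : i ≢ j) u → col u ≡ c-class i≢j → u ≡ inj₁ i ⊎ u ≡ inj₁ j
  c-class-within i≢j u uγ = c-neighbours i≢j u (proj₂ (dominating (c i≢j)) u uγ)

  c-class-hit : ∀ {i j} (i≢j : i ≢ j) → colour i ≡ c-class i≢j ⊎ colour j ≡ c-class i≢j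
  c-class-hit i≢j with surjective (c-class i≢j)
  ... | w , wγ with c-class-within i≢j w wγ
  ...   | inj₁ refl = inj₁ wγ
  ...   | inj₂ refl = inj₂ wγ

  c-class-monochrome : ∀ {i j γ} (i≢j : i ≢ j) → colour i ≡ γ → colour j ≡ γ → c-class i≢j ≡ γ
  c-class-monochrome i≢j iγ jγ with c-class-hit i≢j
  ... | inj₁ iγ′ = trans (sym iγ′) iγ
  ... | inj₂ jγ′ = trans (sym jγ′) jγ

  c-class-shared : ∀ {x y z} (x≢y : x ≢ y) → z ≢ y → colour z ≡ colour y → colour x ≡ c-class x≢y
  c-class-shared x≢y z≢y zy with c-class-hit x≢y
  ... | inj₁ xγ = xγ
  ... | inj₂ yγ with c-class-within x≢y (inj₁ _) (trans zy yγ)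
  ...   | inj₁ refl = trans zy yγ
  ...   | inj₂ z≡y  = ⊥-elim (z≢y (inj₁-injective z≡y))

  size load : Fin k → ℕ
  size j = count (λ i → colour i ≟ j)
  load j = count (λ i → target i ≟ j)

  size≤2 : ∀ j → size j ≤ 2
  size≤2 j = count≤2 (λ i → colour i ≟ j) three-coloured
    where
    three-coloured : ∀ {x y z} → x ≢ y → x ≢ z → y ≢ z →
                     colour x ≡ j → colour y ≡ j → colour z ≡ j → ⊥
    three-coloured {z = z} x≢y x≢z y≢z xj yj zj
      with c-class-within x≢y (inj₁ z) (trans zj (sym (c-class-monochrome x≢y xj yj)))
    ... | inj₁ z≡x = x≢z (sym (inj₁-injective z≡x))
    ... | inj₂ z≡y = y≢z (sym (inj₁-injective z≡y))

  load≤2 : ∀ j → load j ≤ 2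
  load≤2 j = count≤2 (λ i → target i ≟ j) three-dominators
    where
    three-dominators : ∀ {x y z} → x ≢ y → x ≢ z → y ≢ z →
                       target x ≡ j → target y ≡ j → target z ≡ j → ⊥
    three-dominators {x} {y} {z} x≢y x≢z y≢z xj yj zj with surjective j
    ... | inj₁ w , wj = originals-nonadjacent x w (target-dominated x (inj₁ w) (trans wj (sym xj)))
    ... | inj₂ e , wj = no-three-in-two x≢y x≢z y≢z
      (target-dominated x (inj₂ e) (trans wj (sym xj)))
      (target-dominated y (inj₂ e) (trans wj (sym yj)))
      (target-dominated z (inj₂ e) (trans wj (sym zj)))

  size≥1⇒load≡0 : ∀ j → 1 ≤ size j → load j ≡ 0
  size≥1⇒load≡0 j size≥1 with count⇒∃ (λ i → colour i ≟ j) size≥1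
  ... | x , xj = count≡0 (λ i → target i ≟ j)
    λ l lj → originals-nonadjacent l x (target-dominated l (inj₁ x) (trans xj (sym lj)))

  shared-colour-unique : ∀ {p q r s} → p ≢ q → r ≢ s →
                         colour p ≡ colour q → colour r ≡ colour s → colour p ≡ colour r
  shared-colour-unique {p} {q} {r} {s} p≢q r≢s pq rs with r ≟ p
  ... | yes refl = refl
  ... | no r≢p with c-class-within r≢p (inj₁ s) (trans (sym rs) (c-class-shared r≢p (≢-sym p≢q) (sym pq)))
  ...   | inj₁ s≡r  = ⊥-elim (r≢s (sym (inj₁-injective s≡r)))
  ...   | inj₂ refl = sym rs

  vertex-colour-is-c-class : ∀ {p q} → p ≢ q → colour p ≡ colour q →
                             ∀ x → ∃ λ y → Σ (x ≢ y) λ x≢y → colour x ≡ c-class x≢y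
  vertex-colour-is-c-class {p} {q} p≢q pq x with x ≟ p
  ... | yes refl = q , p≢q , c-class-shared p≢q p≢q pq
  ... | no x≢p   = p , x≢p , c-class-shared x≢p (≢-sym p≢q) (sym pq)

  no-edge-has-vertex-colour : ∀ {p q} → p ≢ q → colour p ≡ colour q →
                              ∀ e x → col (inj₂ e) ≢ colour x
  no-edge-has-vertex-colour p≢q pq e x ex with vertex-colour-is-c-class p≢q pq x
  ... | y , x≢y , xγ with c-class-within x≢y (inj₂ e) (trans ex xγ)
  ...   | inj₁ ()
  ...   | inj₂ ()

  module _ {i i′ : Fin n} (i≢i′ : i ≢ i′) (ii′ : target i ≡ target i′)
           (no-vertex-colour : ∀ e x → col (inj₂ e) ≢ colour x) where

    edge-colour-empty : ∀ e → size (col (inj₂ e)) ≡ 0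
    edge-colour-empty e = count≡0 (λ x → colour x ≟ col (inj₂ e)) λ x xe → no-vertex-colour e x (sym xe)

    sole-dominator : ∀ {m} (i≢m : i ≢ m) → i′ ≢ m → ∀ l → target l ≡ col (c i≢m) → l ≡ m
    sole-dominator {m} i≢m i′≢m l lγ
      with incident-edge G (complete i m i≢m) (target-dominated l (c i≢m) (sym lγ))
    ... | inj₂ l≡m = l≡m
    ... | inj₁ refl
      with incident-edge G (complete i m i≢m) (target-dominated i′ (c i≢m) (trans (sym lγ) ii′))
    ...   | inj₁ i′≡i = ⊥-elim (i≢i′ (sym i′≡i))
    ...   | inj₂ i′≡m = ⊥-elim (i′≢m i′≡m)

    c-colour-load : ∀ {m} (i≢m : i ≢ m) → i′ ≢ m →
                    load (col (c i≢m)) ≡ 0 ⊎ (target m ≡ col (c i≢m) × load (col (c i≢m)) ≡ 1)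
    c-colour-load i≢m i′≢m with load (col (c i≢m)) ℕ.≟ 0
    ... | yes load≡0 = inj₁ load≡0
    ... | no load≢0 with count⇒∃ (λ l → target l ≟ col (c i≢m)) (n≢0⇒n>0 load≢0)
    ...   | l , lγ with sole-dominator i≢m i′≢m l lγ
    ...     | refl =
      inj₂ (lγ , ≤-antisym (count≤1 (λ l → target l ≟ col (c i≢m)) only-m) (n≢0⇒n>0 load≢0))
      where
      only-m : ∀ {l₁ l₂} → target l₁ ≡ col (c i≢m) → target l₂ ≡ col (c i≢m) → l₁ ≡ l₂
      only-m l₁γ l₂γ =
        trans (sole-dominator i≢m i′≢m _ l₁γ) (sym (sole-dominator i≢m i′≢m _ l₂γ))

    -- Since a colour is shared, the colour of c_im holds no original vertex, and since v_i, v_i′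
    -- dominate the same class, only v_m can dominate it.
    free-colour : count (λ j → load j ℕ.≟ 1) ≤ 1 → ∃ λ j → size j ≡ 0 × load j ≡ 0
    free-colour singles≤1 with two-others 4≤n i i′
    ... | m₁ , m₂ , m₁≢m₂ , (m₁≢i , m₁≢i′) , (m₂≢i , m₂≢i′)
      with c-colour-load (≢-sym m₁≢i) (≢-sym m₁≢i′) | c-colour-load (≢-sym m₂≢i) (≢-sym m₂≢i′)
    ... | inj₁ load≡0 | _           = _ , edge-colour-empty _ , load≡0
    ... | inj₂ _      | inj₁ load≡0 = _ , edge-colour-empty _ , load≡0
    ... | inj₂ (_ , single₁) | inj₂ (m₂γ₂ , single₂) =
      ⊥-elim (m₁≢m₂ (sym (sole-dominator (≢-sym m₁≢i) (≢-sym m₁≢i′) m₂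
                                         (trans m₂γ₂ (sym γ₁≡γ₂)))))
      where
      γ₁≡γ₂ : col (c (≢-sym m₁≢i)) ≡ col (c (≢-sym m₂≢i))
      γ₁≡γ₂ = count≤1⇒unique (λ j → load j ℕ.≟ 1) singles≤1 single₁ single₂

  shared? : Decidable (λ j → size j ≡ 2)
  shared? j = size j ℕ.≟ 2

  single? : Decidable (λ j → load j ≡ 1)
  single? j = load j ℕ.≟ 1

  double? : Decidable (λ j → load j ≡ 2)
  double? j = load j ℕ.≟ 2

  free? : Decidable (λ j → size j ≡ 0 × load j ≡ 0)
  free? j = (size j ℕ.≟ 0) ×-dec (load j ℕ.≟ 0)

  budget : n + count double? + count single? + count free? ≤ k + count shared?
  budget = subst₂ _≤_ colours-used colours-available
    (sum-mono λ j → colour-budget (size j) (load j) (size≤2 j) (load≤2 j) (size≥1⇒load≡0 j))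
    where
    open ≡-Reasoning
    colours-used : sum (λ j → size j + 𝟙 (double? j) + 𝟙 (single? j) + 𝟙 (free? j)) ≡
                   n + count double? + count single? + count free?
    colours-used = begin
      sum (λ j → size j + 𝟙 (double? j) + 𝟙 (single? j) + 𝟙 (free? j))
        ≡⟨ ∑-distrib-+ (λ j → size j + 𝟙 (double? j) + 𝟙 (single? j)) _ ⟩
      sum (λ j → size j + 𝟙 (double? j) + 𝟙 (single? j)) + count free?
        ≡⟨ cong (_+ count free?) (∑-distrib-+ (λ j → size j + 𝟙 (double? j)) _) ⟩
      sum (λ j → size j + 𝟙 (double? j)) + count single? + count free?
        ≡⟨ cong (λ s → s + count single? + count free?) (∑-distrib-+ size _) ⟩
      sum size + count double? + count single? + count free?
        ≡⟨ cong (λ s → s + count double? + count single? + count free?) (fibre-count-sum colour) ⟩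
      n + count double? + count single? + count free? ∎
    colours-available : sum (λ j → 1 + 𝟙 (shared? j)) ≡ k + count shared?
    colours-available =
      trans (∑-distrib-+ {k} (λ _ → 1) (𝟙 ∘ shared?)) (cong (_+ count shared?) (sum-ones k))

  load-total : n ≡ count double? + count double? + count single?
  load-total = begin
    n
      ≡⟨ fibre-count-sum target ⟨
    sum load
      ≡⟨ sum-cong-≗ (λ j → d≤2⇒d≡2+2+1 (load j) (load≤2 j)) ⟩
    sum (λ j → 𝟙 (double? j) + 𝟙 (double? j) + 𝟙 (single? j))
      ≡⟨ ∑-distrib-+ (λ j → 𝟙 (double? j) + 𝟙 (double? j)) _ ⟩
    sum (λ j → 𝟙 (double? j) + 𝟙 (double? j)) + count single?
      ≡⟨ cong (_+ count single?) (∑-distrib-+ (𝟙 ∘ double?) _) ⟩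
    count double? + count double? + count single? ∎
    where open ≡-Reasoning

  shared-pair : ∀ {j} → size j ≡ 2 → ∃ λ p → ∃ λ q → p ≢ q × colour p ≡ j × colour q ≡ j
  shared-pair {j} size≡2 = count≥2⇒∃₂ (λ i → colour i ≟ j) (≤-reflexive (sym size≡2))

  shared≤1 : count shared? ≤ 1
  shared≤1 = count≤1 shared? λ size≡2 size′≡2 →
    let (p , q , p≢q , pj , qj)     = shared-pair size≡2
        (r , s , r≢s , rj′ , sj′) = shared-pair size′≡2
    in trans (sym pj) (trans (shared-colour-unique p≢q r≢s (trans pj (sym qj)) (trans rj′ (sym sj′))) rj′)

  double≥1 : count single? ≤ 1 → 1 ≤ count double?
  double≥1 singles≤1 with count double? | load-total
  ... | zero  | n≡singles =
    contradiction (≤-trans 4≤n (≤-trans (≤-reflexive n≡singles) singles≤1)) λ { (s≤s ()) }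
  ... | suc _ | _         = s≤s z≤n

  free≥1 : count shared? ≡ 1 → count single? ≤ 1 → 1 ≤ count free?
  free≥1 shared≡1 singles≤1 =
    let (_ , size≡2)                  = count⇒∃ shared? (≤-reflexive (sym shared≡1))
        (p , q , p≢q , pj , qj)       = shared-pair size≡2
        (j₀ , load≡2)                 = count⇒∃ double? (double≥1 singles≤1)
        (i , i′ , i≢i′ , ij₀ , i′j₀) = count≥2⇒∃₂ (λ i → target i ≟ j₀) (≤-reflexive (sym load≡2))
        (_ , free)                    = free-colour i≢i′ (trans ij₀ (sym i′j₀))
                                          (no-edge-has-vertex-colour p≢q (trans pj (sym qj))) singles≤1
    in count≥1 free? free

  lower-bound : n + ⌈ n /2⌉ ≤ k
  lower-bound = n+⌈n/2⌉≤k load-total budget shared≤1 free≥1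

-- Colourings of C(G) with few colours

module PairedDesign {n : ℕ} (G : Graph n) (h : Fin n → ℕ)
  (h-fibres : ∀ {x y z} → Universal G x → Universal G y → Universal G z →
              x ≢ y → x ≢ z → y ≢ z → h x ≡ h y → h x ≡ h z → ⊥)
  {u₀ u₁ : Fin n} (u₀≢u₁ : u₀ ≢ u₁) (U₀ : Universal G u₀) (U₁ : Universal G u₁) where

  Partners : Fin n → Fin n → Set
  Partners x y = Universal G x × Universal G y × h x ≡ h y

  partners-sym : ∀ {x y} → Partners x y → Partners y x
  partners-sym (Ux , Uy , hx≡hy) = Uy , Ux , sym hx≡hy

  Lonely : Fin n → Set
  Lonely x = Universal G x × ∀ y → Universal G y → x ≢ y → h x ≢ h y

  lonely? : Decidable Lonely
  lonely? x = universal? G x ×-dec all? (λ y → universal? G y →-dec ¬? (x ≟ y) →-dec ¬? (h x ℕ.≟ h y))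

  Owns : Fin n → Edge G → Set
  Owns z e = (z ≡ src G e ⊎ z ≡ tgt G e) × Universal G z × (Partners (src G e) (tgt G e) ⊎ Lonely z)

  owner? : ∀ e → Dec (∃ λ z → Owns z e)
  owner? e = any? λ z → ((z ≟ src G e) ⊎-dec (z ≟ tgt G e)) ×-dec universal? G z ×-dec
    ((universal? G (src G e) ×-dec universal? G (tgt G e) ×-dec (h (src G e) ℕ.≟ h (tgt G e))) ⊎-dec lonely? z)

  merge : Fin n → Fin n
  merge x with x ≟ u₁
  ... | yes _ = u₀
  ... | no _  = x

  colour : CVertex G → ℕ
  colour (inj₁ x) = toℕ (merge x)
  colour (inj₂ e) with owner? e
  ... | yes (z , _) = n + h z
  ... | no _        = toℕ u₁

  merge-cases : ∀ x → (x ≡ u₁ × merge x ≡ u₀) ⊎ (x ≢ u₁ × merge x ≡ x)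
  merge-cases x with x ≟ u₁
  ... | yes x≡u₁ = inj₁ (x≡u₁ , refl)
  ... | no x≢u₁  = inj₂ (x≢u₁ , refl)

  merge-self : ∀ {x} → x ≢ u₁ → merge x ≡ x
  merge-self {x} x≢u₁ with merge-cases x
  ... | inj₁ (x≡u₁ , _) = ⊥-elim (x≢u₁ x≡u₁)
  ... | inj₂ (_ , m≡x)  = m≡x

  merge≢u₁ : ∀ x → merge x ≢ u₁
  merge≢u₁ x with merge-cases x
  ... | inj₁ (_ , m≡u₀)   = λ m≡u₁ → u₀≢u₁ (trans (sym m≡u₀) m≡u₁)
  ... | inj₂ (x≢u₁ , m≡x) = λ m≡u₁ → x≢u₁ (trans (sym m≡x) m≡u₁)

  merge-fixed : ∀ {x z} → z ≢ u₀ → merge x ≡ z → x ≡ z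
  merge-fixed {x} z≢u₀ m≡z with merge-cases x
  ... | inj₁ (_ , m≡u₀) = ⊥-elim (z≢u₀ (trans (sym m≡z) m≡u₀))
  ... | inj₂ (_ , m≡x)  = trans (sym m≡x) m≡z

  merge-u₀ : ∀ {x} → merge x ≡ u₀ → x ≡ u₀ ⊎ x ≡ u₁
  merge-u₀ {x} m≡u₀ with merge-cases x
  ... | inj₁ (x≡u₁ , _) = inj₂ x≡u₁
  ... | inj₂ (_ , m≡x)  = inj₁ (trans (sym m≡x) m≡u₀)

  merge-identifies-adjacent : ∀ {x y} → x ≢ y → merge x ≡ merge y → Adj G x y
  merge-identifies-adjacent {x} {y} x≢y mx≡my with merge-cases x | merge-cases y
  ... | inj₁ (refl , _) | inj₁ (refl , _) = ⊥-elim (x≢y refl)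
  ... | inj₁ (refl , _) | inj₂ _          = U₁ y x≢y
  ... | inj₂ _          | inj₁ (refl , _) = Adj-sym G (U₁ x (≢-sym x≢y))
  ... | inj₂ (_ , mx)   | inj₂ (_ , my)   = ⊥-elim (x≢y (trans (sym mx) (trans mx≡my my)))

  edge-colour-cases : ∀ e → (∃ λ z → Owns z e × colour (inj₂ e) ≡ n + h z) ⊎
                            (¬ (∃ λ z → Owns z e) × colour (inj₂ e) ≡ toℕ u₁)
  edge-colour-cases e with owner? e
  ... | yes (z , owns) = inj₁ (z , owns , refl)
  ... | no unowned     = inj₂ (unowned , refl)

  small≢large : ∀ {m} (z : Fin n) → toℕ z ≢ n + m
  small≢large {m} z z≡n+m = <-irrefl z≡n+m (<-≤-trans (toℕ<n z) (m≤m+n n m))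

  vertex≢edge : ∀ x e → colour (inj₁ x) ≢ colour (inj₂ e)
  vertex≢edge x e x≡e with edge-colour-cases e
  ... | inj₁ (_ , _ , e≡) = small≢large (merge x) (trans x≡e e≡)
  ... | inj₂ (_ , e≡u₁)   = merge≢u₁ x (toℕ-injective (trans x≡e e≡u₁))

  proper : Proper (C G) colour
  proper (inj₁ x) (inj₁ y) (x≢y , ¬xy) x≡y =
    subst T ¬xy (merge-identifies-adjacent x≢y (toℕ-injective x≡y))
  proper (inj₁ x) (inj₂ e) _ = vertex≢edge x e
  proper (inj₂ e) (inj₁ x) _ = vertex≢edge x e ∘ sym

  singleton : ∀ {z} → z ≢ u₀ → z ≢ u₁ → ∀ u → colour u ≡ colour (inj₁ z) → u ≡ inj₁ z
  singleton z≢u₀ z≢u₁ (inj₁ x) x≡z =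
    cong inj₁ (merge-fixed z≢u₀ (trans (toℕ-injective x≡z) (merge-self z≢u₁)))
  singleton {z} _ _ (inj₂ e) e≡z = ⊥-elim (vertex≢edge z e (sym e≡z))

  dominated-by-singleton : ∀ v {z} → z ≢ u₀ → z ≢ u₁ → CAdj G v (inj₁ z) → Dominated (C G) colour v
  dominated-by-singleton v {z} z≢u₀ z≢u₁ v~z =
    inj₁ z , λ u u≡z → subst (CAdj G v) (sym (singleton z≢u₀ z≢u₁ u u≡z)) v~z

  edge-dominated : ∀ e → Dominated (C G) colour (inj₂ e)
  edge-dominated e with (src G e ≟ u₀) ⊎-dec (src G e ≟ u₁) | (tgt G e ≟ u₀) ⊎-dec (tgt G e ≟ u₁)
  ... | no s∉    | _      = dominated-by-singleton (inj₂ e) (s∉ ∘ inj₁) (s∉ ∘ inj₂) (inj₁ refl)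
  ... | yes _    | no t∉  = dominated-by-singleton (inj₂ e) (t∉ ∘ inj₁) (t∉ ∘ inj₂) (inj₂ refl)
  ... | yes s∈   | yes t∈ = inj₁ u₀ , merged-class
    where
    merged-class : ∀ u → colour u ≡ colour (inj₁ u₀) → CAdj G (inj₂ e) u
    merged-class (inj₁ x) x≡u₀ =
      pair-cover s∈ t∈ (src≢tgt G e) (merge-u₀ (trans (toℕ-injective x≡u₀) (merge-self u₀≢u₁)))
    merged-class (inj₂ e′) e′≡u₀ = ⊥-elim (vertex≢edge u₀ e′ (sym e′≡u₀))

  universal-class : ∀ {x} → Universal G x → ∀ u → colour u ≡ n + h x → CAdj G (inj₁ x) u
  universal-class Ux (inj₁ y) y≡ = ⊥-elim (small≢large (merge y) y≡)
  universal-class {x} Ux (inj₂ e) e≡ with edge-colour-cases e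
  ... | inj₂ (_ , e≡u₁) = ⊥-elim (small≢large u₁ (trans (sym e≡u₁) e≡))
  ... | inj₁ (z , (z∈e , _ , reason) , e≡z) with (x ≟ src G e) ⊎-dec (x ≟ tgt G e)
  ...   | yes x∈e = x∈e
  ...   | no x∉e  = ⊥-elim (not-owned reason)
    where
    hz≡hx : h z ≡ h x
    hz≡hx = +-cancelˡ-≡ n _ _ (trans (sym e≡z) e≡)
    not-owned : Partners (src G e) (tgt G e) ⊎ Lonely z → ⊥
    not-owned (inj₂ (_ , lonely)) = lonely x Ux (λ { refl → x∉e z∈e }) hz≡hx
    not-owned (inj₁ (Us , Ut , hs≡ht)) =
      h-fibres Us Ut Ux (src≢tgt G e) (x∉e ∘ inj₁ ∘ sym) (x∉e ∘ inj₂ ∘ sym) hs≡ht hs≡hx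
      where
      hs≡hx : h (src G e) ≡ h x
      hs≡hx = Sum.[ (λ z≡s → trans (cong h (sym z≡s)) hz≡hx)
                  , (λ z≡t → trans hs≡ht (trans (cong h (sym z≡t)) hz≡hx)) ]′ z∈e

  partner-edge : ∀ {x y} (xy : Adj G x y) → Partners x y → colour (inj₂ (edge G xy)) ≡ n + h x
  partner-edge xy partners@(Ux , _ , hx≡hy) with edge-colour-cases (edge G xy)
  ... | inj₁ (z , (z∈e , _) , e≡z) with incident-edge G xy z∈e
  ...   | inj₁ refl = e≡z
  ...   | inj₂ refl = trans e≡z (cong (n +_) (sym hx≡hy))
  partner-edge xy partners@(Ux , _ , _) | inj₂ (unowned , _) =
    ⊥-elim (unowned (_ , edge-incident G xy (inj₁ refl) , Ux , inj₁ (on-edge⁺ G partners-sym xy partners)))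

  lonely-edge : ∀ {x y} (xy : Adj G x y) → Lonely x → ¬ Lonely y → colour (inj₂ (edge G xy)) ≡ n + h x
  lonely-edge {x} {y} xy lonely-x ¬lonely-y with edge-colour-cases (edge G xy)
  ... | inj₁ (_ , (_ , _ , inj₁ partners) , _) with on-edge⁻ G partners-sym xy partners
  ...   | _ , Uy , hx≡hy = ⊥-elim (proj₂ lonely-x y Uy (Adj⇒≢ G xy) hx≡hy)
  lonely-edge xy lonely-x ¬lonely-y | inj₁ (z , (z∈e , _ , inj₂ lonely-z) , e≡z) with incident-edge G xy z∈e
  ...   | inj₁ refl = e≡z
  ...   | inj₂ refl = ⊥-elim (¬lonely-y lonely-z)
  lonely-edge xy lonely-x ¬lonely-y | inj₂ (unowned , _) =
    ⊥-elim (unowned (_ , edge-incident G xy (inj₁ refl) , proj₁ lonely-x , inj₂ lonely-x))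

  module _ (lonely-neighbour : ∀ {x} → Lonely x → ∃ λ y → Adj G x y × ¬ Lonely y) where

    universal-witness : ∀ {x} → Universal G x → ∃ λ e → colour (inj₂ e) ≡ n + h x
    universal-witness {x} Ux with any? (λ y → universal? G y ×-dec ¬? (x ≟ y) ×-dec (h x ℕ.≟ h y))
    ... | yes (y , Uy , x≢y , hx≡hy) = edge G (Ux y x≢y) , partner-edge (Ux y x≢y) (Ux , Uy , hx≡hy)
    ... | no no-partner =
      let lonely-x              = Ux , λ y Uy x≢y hx≡hy → no-partner (y , Uy , x≢y , hx≡hy)
          (y , xy , ¬lonely-y) = lonely-neighbour lonely-x
      in edge G xy , lonely-edge xy lonely-x ¬lonely-y

    dominating : Dominating (C G) colour
    dominating (inj₂ e) = edge-dominated e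
    dominating (inj₁ x) with universal? G x
    ... | yes Ux = let (e , e≡) = universal-witness Ux in
                   inj₂ e , λ u u≡e → universal-class Ux u (trans u≡e e≡)
    ... | no ¬Ux = let (y , x~y , ¬Uy) = non-universal-witness G ¬Ux in
                   dominated-by-singleton (inj₁ x) (λ { refl → ¬Uy U₀ }) (λ { refl → ¬Uy U₁ }) x~y

    paired-colouring : ∀ {K} → (∀ {x} → Universal G x → n + h x < K) → ∃ λ k → k ≤ K × TDC (C G) k
    paired-colouring {K} bound = compress-ℕ (C G) (searchable-CVertex G) colour colour<K proper dominating
      where
      n<K : n < K
      n<K = ≤-<-trans (m≤m+n n (h u₀)) (bound U₀)
      colour<K : ∀ v → colour v < K
      colour<K (inj₁ x) = <-trans (toℕ<n (merge x)) n<K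
      colour<K (inj₂ e) with edge-colour-cases e
      ... | inj₁ (z , (_ , Uz , _) , e≡) = subst (_< K) (sym e≡) (bound Uz)
      ... | inj₂ (_ , e≡u₁)              = subst (_< K) (sym e≡u₁) (<-trans (toℕ<n u₁) n<K)

-- The spare colour is n if G has no universal vertex and toℕ u for its only universal vertex u.
module HubDesign {n : ℕ} (G : Graph n) {a b : Fin n} (a≢b : a ≢ b)
  (universal-unique : ∀ {x y} → Universal G x → Universal G y → x ≡ y)
  (spare : ℕ) (spare≤n : spare ≤ n)
  (spare-universal : ∀ {x} → toℕ x ≡ spare → Universal G x)
  (spare≢n : ∀ {x} → Universal G x → spare ≢ n) where

  Hub : Edge G → Set
  Hub e = Universal G (src G e) ⊎ Universal G (tgt G e)

  hub : ∀ {x e} → CAdj G (inj₁ x) (inj₂ e) → Universal G x → Hub e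
  hub x∈e Ux = Sum.map (λ x≡s → subst (Universal G) x≡s Ux) (λ x≡t → subst (Universal G) x≡t Ux) x∈e

  colour : CVertex G → ℕ
  colour (inj₁ x) = toℕ x
  colour (inj₂ e) with universal? G (src G e) ⊎-dec universal? G (tgt G e)
  ... | yes _ = n
  ... | no _  = spare

  edge-colour-cases : ∀ e → (Hub e × colour (inj₂ e) ≡ n) ⊎ (¬ Hub e × colour (inj₂ e) ≡ spare)
  edge-colour-cases e with universal? G (src G e) ⊎-dec universal? G (tgt G e)
  ... | yes is-hub = inj₁ (is-hub , refl)
  ... | no ¬hub    = inj₂ (¬hub , refl)

  toℕ≢n : ∀ (x : Fin n) → toℕ x ≢ n
  toℕ≢n x x≡n = <-irrefl x≡n (toℕ<n x)

  incident≢ : ∀ {x e} → CAdj G (inj₁ x) (inj₂ e) → colour (inj₁ x) ≢ colour (inj₂ e)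
  incident≢ {x} {e} x∈e x≡e with edge-colour-cases e
  ... | inj₁ (_ , e≡n)        = toℕ≢n x (trans x≡e e≡n)
  ... | inj₂ (¬hub , e≡spare) = ¬hub (hub {e = e} x∈e (spare-universal (trans x≡e e≡spare)))

  proper : Proper (C G) colour
  proper (inj₁ x) (inj₁ y) (x≢y , _) = x≢y ∘ toℕ-injective
  proper (inj₁ x) (inj₂ e) x∈e       = incident≢ x∈e
  proper (inj₂ e) (inj₁ x) x∈e       = incident≢ x∈e ∘ sym

  singleton : ∀ {z} → ¬ Universal G z → ∀ u → colour u ≡ toℕ z → u ≡ inj₁ z
  singleton ¬Uz (inj₁ x) x≡z = cong inj₁ (toℕ-injective x≡z)
  singleton {z} ¬Uz (inj₂ e) e≡z with edge-colour-cases e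
  ... | inj₁ (_ , e≡n)     = ⊥-elim (toℕ≢n z (trans (sym e≡z) e≡n))
  ... | inj₂ (_ , e≡spare) = ⊥-elim (¬Uz (spare-universal (trans (sym e≡z) e≡spare)))

  dominated-by-singleton : ∀ v {z} → ¬ Universal G z → CAdj G v (inj₁ z) → Dominated (C G) colour v
  dominated-by-singleton v {z} ¬Uz v~z = inj₁ z , λ u u≡z → subst (CAdj G v) (sym (singleton ¬Uz u u≡z)) v~z

  hub-class : ∀ {x} → Universal G x → ∀ u → colour u ≡ n → CAdj G (inj₁ x) u
  hub-class Ux (inj₁ z) z≡n = ⊥-elim (toℕ≢n z z≡n)
  hub-class Ux (inj₂ e) e≡n with edge-colour-cases e
  ... | inj₁ (inj₁ Us , _) = inj₁ (universal-unique Ux Us)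
  ... | inj₁ (inj₂ Ut , _) = inj₂ (universal-unique Ux Ut)
  ... | inj₂ (_ , e≡spare) = ⊥-elim (spare≢n Ux (trans (sym e≡spare) e≡n))

  another : ∀ x → ∃ λ y → x ≢ y
  another x with x ≟ a
  ... | yes refl = b , a≢b
  ... | no x≢a   = a , x≢a

  universal-dominated : ∀ {x} → Universal G x → Dominated (C G) colour (inj₁ x)
  universal-dominated {x} Ux = inj₂ (edge G xy) , λ u u≡xy → hub-class Ux u (trans u≡xy hub-edge)
    where
    xy : Adj G x (proj₁ (another x))
    xy = Ux (proj₁ (another x)) (proj₂ (another x))
    hub-edge : colour (inj₂ (edge G xy)) ≡ n
    hub-edge with edge-colour-cases (edge G xy)
    ... | inj₁ (_ , e≡n)  = e≡n
    ... | inj₂ (¬hub , _) = ⊥-elim (¬hub (hub {e = edge G xy} (edge-incident G xy (inj₁ refl)) Ux))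

  dominating : Dominating (C G) colour
  dominating (inj₁ x) with universal? G x
  ... | yes Ux = universal-dominated Ux
  ... | no ¬Ux = let (y , x~y , ¬Uy) = non-universal-witness G ¬Ux in dominated-by-singleton (inj₁ x) ¬Uy x~y
  dominating (inj₂ e) with universal? G (src G e)
  ... | no ¬Us = dominated-by-singleton (inj₂ e) ¬Us (inj₁ refl)
  ... | yes Us = dominated-by-singleton (inj₂ e) (src≢tgt G e ∘ universal-unique Us) (inj₂ refl)

  hub-colouring : ∃ λ k → k ≤ suc n × TDC (C G) k
  hub-colouring = compress-ℕ (C G) (searchable-CVertex G) colour colour<1+n proper dominating
    where
    colour<1+n : ∀ v → colour v < suc n
    colour<1+n (inj₁ x) = <-trans (toℕ<n x) (n<1+n n)
    colour<1+n (inj₂ e) with edge-colour-cases e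
    ... | inj₁ (_ , e≡n)     = subst (_< suc n) (sym e≡n) (n<1+n n)
    ... | inj₂ (_ , e≡spare) = subst (_< suc n) (sym e≡spare) (s≤s spare≤n)

complete-colouring : ∀ {n} (G : Graph n) → Complete G → 2 ≤ n →
                     ∃ λ k → k ≤ n + ⌈ n /2⌉ × TDC (C G) k
complete-colouring {suc (suc m)} G complete (s≤s (s≤s z≤n)) = paired-colouring lonely-neighbour bound
  where
  open PairedDesign G (λ x → ⌊ toℕ x /2⌋)
    (λ _ _ _ x≢y x≢z y≢z →
      ⌊/2⌋-fibres (x≢y ∘ toℕ-injective) (x≢z ∘ toℕ-injective) (y≢z ∘ toℕ-injective))
    {zero} {suc zero} (λ ()) (complete zero) (complete (suc zero))
  zero-not-lonely : ¬ Lonely zero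
  zero-not-lonely (_ , lonely) = lonely (suc zero) (complete (suc zero)) (λ ()) refl
  lonely-neighbour : ∀ {x} → Lonely x → ∃ λ y → Adj G x y × ¬ Lonely y
  lonely-neighbour {x} lonely-x = zero , complete x zero (λ { refl → zero-not-lonely lonely-x }) , zero-not-lonely
  bound : ∀ {x} → Universal G x → suc (suc m) + ⌊ toℕ x /2⌋ < suc (suc m) + ⌈ suc (suc m) /2⌉
  bound {x} _ = +-monoʳ-< (suc (suc m)) (⌊n/2⌋-mono (s≤s (toℕ<n x)))

module _ {n : ℕ} (G : Graph n) (4≤n : 4 ≤ n) {a b : Fin n} (a≢b : a ≢ b)
         (¬Ua : ¬ Universal G a) (¬Ub : ¬ Universal G b) where

  3+rank≤n : ∀ {x} → Universal G x → 3 + rank (universal? G) x ≤ n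
  3+rank≤n {x} Ux = begin
    3 + rank (universal? G) x
      ≡⟨ +-comm 2 (suc (rank (universal? G) x)) ⟩
    suc (rank (universal? G) x) + 2
      ≤⟨ +-mono-≤ (rank<count (universal? G) (universal? G) Ux λ _ Uy → Uy)
                  (count≥2 (∁? (universal? G)) a≢b ¬Ua ¬Ub) ⟩
    count (universal? G) + count (∁? (universal? G))
      ≡⟨ count-complement (universal? G) ⟩
    n ∎
    where open ≤-Reasoning

  two-universal-colouring : ∀ {u₀ u₁} → u₀ ≢ u₁ → Universal G u₀ → Universal G u₁ →
                            ∃ λ k → k < n + ⌈ n /2⌉ × TDC (C G) k
  two-universal-colouring u₀≢u₁ U₀ U₁ with paired-colouring lonely-neighbour bound
    where
    open PairedDesign G (λ x → ⌊ rank (universal? G) x /2⌋)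
      (λ Ux Uy Uz x≢y x≢z y≢z → ⌊/2⌋-fibres (x≢y ∘ rank-injective (universal? G) Ux Uy)
        (x≢z ∘ rank-injective (universal? G) Ux Uz) (y≢z ∘ rank-injective (universal? G) Uy Uz))
      u₀≢u₁ U₀ U₁
    lonely-neighbour : ∀ {x} → Lonely x → ∃ λ y → Adj G x y × ¬ Lonely y
    lonely-neighbour (Ux , _) = a , Ux a (λ { refl → ¬Ua Ux }) , ¬Ua ∘ proj₁
    bound : ∀ {x} → Universal G x → n + ⌊ rank (universal? G) x /2⌋ < pred (n + ⌈ n /2⌉)
    bound Ux = suc[m]≤n⇒m≤pred[n] (2+n+⌊r/2⌋≤n+⌈n/2⌉ (3+rank≤n Ux))
  ... | k , k≤ , tdc =
    k , m≤pred[n]⇒suc[m]≤n {{>-nonZero (≤-trans (s≤s z≤n) (≤-trans 4≤n (m≤m+n n _)))}} k≤ , tdc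

  ≤1+n⇒<n+⌈n/2⌉ : (∃ λ k → k ≤ suc n × TDC (C G) k) → ∃ λ k → k < n + ⌈ n /2⌉ × TDC (C G) k
  ≤1+n⇒<n+⌈n/2⌉ (k , k≤1+n , tdc) = k , ≤-<-trans k≤1+n 1+n<n+⌈n/2⌉ , tdc
    where
    1+n<n+⌈n/2⌉ : suc n < n + ⌈ n /2⌉
    1+n<n+⌈n/2⌉ = subst (_≤ n + ⌈ n /2⌉) (+-comm n 2) (+-monoʳ-≤ n (⌈n/2⌉-mono 4≤n))

  non-complete-colouring : ∃ λ k → k < n + ⌈ n /2⌉ × TDC (C G) k
  non-complete-colouring
    with any? (λ u₀ → any? (λ u₁ → universal? G u₀ ×-dec universal? G u₁ ×-dec ¬? (u₀ ≟ u₁)))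
  ... | yes (u₀ , u₁ , U₀ , U₁ , u₀≢u₁) = two-universal-colouring u₀≢u₁ U₀ U₁
  ... | no at-most-one with any? (universal? G)
  ...   | yes (u , Uu) = ≤1+n⇒<n+⌈n/2⌉ (HubDesign.hub-colouring G a≢b unique (toℕ u) (<⇒≤ (toℕ<n u))
                           (λ x≡u → subst (Universal G) (sym (toℕ-injective x≡u)) Uu) (λ _ → <⇒≢ (toℕ<n u)))
    where
    unique : ∀ {x y} → Universal G x → Universal G y → x ≡ y
    unique {x} {y} Ux Uy with x ≟ y
    ... | yes x≡y = x≡y
    ... | no x≢y  = ⊥-elim (at-most-one (x , y , Ux , Uy , x≢y))
  ...   | no none = ≤1+n⇒<n+⌈n/2⌉ (HubDesign.hub-colouring G a≢b (λ Ux _ → ⊥-elim (none (_ , Ux))) n ≤-refl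
                      (λ {x} x≡n → ⊥-elim (<⇒≢ (toℕ<n x) x≡n)) (λ Ux → ⊥-elim (none (_ , Ux))))

module _ {n : ℕ} (G : Graph n) where

  complete⇒≅K : Complete G → G ≅ K n
  complete⇒≅K complete = ↔-id (Fin n) , adj≡Kadj
    where
    adj≡Kadj : ∀ i j → adj G i j ≡ Kadj i j
    adj≡Kadj i j with i ≟ j
    ... | yes refl = Graph.irref G i
    ... | no i≢j with adj G i j | complete i j i≢j
    ...   | true | _ = refl

  ≅K⇒complete : G ≅ K n → Complete G
  ≅K⇒complete (f , adj≡) i j i≢j =
    subst T (sym (adj≡ i j)) (Kadj-distinct (i≢j ∘ Injection.injective (↔⇒↣ f)))
    where
    Kadj-distinct : ∀ {x y : Fin n} → x ≢ y → T (Kadj x y)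
    Kadj-distinct {x} {y} x≢y with x ≟ y
    ... | yes x≡y = x≢y x≡y
    ... | no _    = _

theorem2p5 : (n : ℕ) → 4 ≤ n → (G : Graph n) → Connected G →
    (TDCNumberIs (C G) (n + ⌈ n /2⌉) ⇔ (G ≅ K n))
theorem2p5 n 4≤n G _ = mk⇔ only-complete complete-attains
  where
  complete-attains : G ≅ K n → TDCNumberIs (C G) (n + ⌈ n /2⌉)
  complete-attains G≅K with complete-colouring G (≅K⇒complete G G≅K) (≤-trans (s≤s (s≤s z≤n)) 4≤n)
  ... | k , k≤m , tdc = subst (TDC (C G)) (≤-antisym k≤m (lower-bound tdc)) tdc ,
                        λ k′ k′<m tdc′ → <⇒≱ k′<m (lower-bound tdc′)
    where
    lower-bound : ∀ {k} → TDC (C G) k → n + ⌈ n /2⌉ ≤ k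
    lower-bound = LowerBound.lower-bound G (≅K⇒complete G G≅K) 4≤n
  only-complete : TDCNumberIs (C G) (n + ⌈ n /2⌉) → G ≅ K n
  only-complete (_ , minimal) with all? (universal? G)
  ... | yes complete = complete⇒≅K G complete
  ... | no ¬complete with ¬∀⟶∃¬ n _ (universal? G) ¬complete
  ...   | a , ¬Ua with non-universal-witness G ¬Ua
  ...     | b , (a≢b , _) , ¬Ub with non-complete-colouring G 4≤n a≢b ¬Ua ¬Ub
  ...       | k , k<m , tdc = ⊥-elim (minimal k k<m tdc)
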